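{- Let $D$ and $L$ be distributive lattices, with $D$ finite and $L$ having a least element $0$, let $f\colon D\to L$ be a join-homomorphism, and let $\vec e=(e_p\mid p\in\mathrm{J}(D))$ be a consonance kernel for $f$. For $x,y\in D$ set $x\oslash_{\vec e}y=\bigvee\{e_p: p\in\mathrm{J}(D),\ p\le x,\ p\not\le y\}$. Then $f(x)=f(x\wedge y)\vee(x\oslash_{\vec e}y)$ for all $x,y\in D$. Moreover, $f$ is a lattice homomorphism.
   Context: $\mathrm{J}(D)$ denotes the set of (nonzero) join-irreducible elements of the finite distributive lattice $D$ and, for $p\in\mathrm{J}(D)$, $p_*$ denotes its unique lower cover. A consonance kernel for $f$ is a family $(e_p\mid p\in\mathrm{J}(D))$ of elements of $L$ such that $f(p)=f(p_*)\vee e_p$ for every $p\in\mathrm{J}(D)$, and $e_p\wedge e_q=0$ whenever $p,q\in\mathrm{J}(D)$ are incomparable. -}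

module Defs where

open import Level using (Level; _⊔_)
open import Algebra.Lattice.Bundles using (DistributiveLattice)
open import Data.Bool using (if_then_else_)
open import Data.List using (List; []; _∷_; foldr)
open import Data.List.Relation.Unary.Any using (Any; here; there)
open import Data.List.Relation.Unary.All as All using (All; []; _∷_; all?)
open import Data.Product using (_×_; _,_)
open import Data.Sum using (_⊎_; inj₁; inj₂)
open import Relation.Nullary using (¬_; Dec; yes; no; does)
open import Relation.Nullary.Decidable using (¬?; _×-dec_; _⊎-dec_; _→-dec_)
open import Relation.Binary using (Decidable)

module _ {c ℓ : Level} (D : DistributiveLattice c ℓ) where
  open DistributiveLattice D

  _≤_ : Carrier → Carrier → Set ℓ
  x ≤ y = x ≈ x ∧ y

  IsLeast : Carrier → Set (c ⊔ ℓ)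
  IsLeast p = ∀ q → p ≤ q

  IsJoinIrreducible : Carrier → Set (c ⊔ ℓ)
  IsJoinIrreducible p = ¬ IsLeast p × (∀ a b → p ≈ a ∨ b → p ≈ a ⊎ p ≈ b)

  IsLowerCover : Carrier → Carrier → Set (c ⊔ ℓ)
  IsLowerCover q p = q ≤ p × ¬ (q ≈ p) × (∀ r → q ≤ r → r ≤ p → r ≈ q ⊎ r ≈ p)

  record IsFinite : Set (c ⊔ ℓ) where
    field
      enum     : List Carrier
      complete : ∀ x → Any (x ≈_) enum
      _≟_      : Decidable _≈_

  module FiniteOps (fin : IsFinite) where
    open IsFinite fin

    _≤?_ : ∀ x y → Dec (x ≤ y)
    x ≤? y = x ≟ (x ∧ y)

    private
      fromAny : ∀ {p} {P : Carrier → Set p} → (∀ {x y} → x ≈ y → P y → P x) →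
                ∀ {x xs} → Any (x ≈_) xs → All P xs → P x
      fromAny resp (here x≈y) (py ∷ _) = resp x≈y py
      fromAny resp (there i) (_ ∷ ps) = fromAny resp i ps

      allDec : ∀ {p} (P : Carrier → Set p) → (∀ {x y} → x ≈ y → P y → P x) →
               (∀ x → Dec (P x)) → Dec (∀ x → P x)
      allDec P resp P? with all? P? enum
      ... | yes a = yes (λ x → fromAny resp (complete x) a)
      ... | no ¬a = no (λ h → ¬a (All.tabulate (λ {y} _ → h y)))

      module _ (p : Carrier) where
        Q : Carrier → Carrier → Set ℓ
        Q a b = p ≈ a ∨ b → p ≈ a ⊎ p ≈ b

        Q? : ∀ a b → Dec (Q a b)
        Q? a b = (p ≟ (a ∨ b)) →-dec ((p ≟ a) ⊎-dec (p ≟ b))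

        respA : ∀ {a a'} → a ≈ a' → (∀ b → Q a' b) → ∀ b → Q a b
        respA {a} {a'} e h b p≈ab with h b (trans p≈ab (∨-cong e refl))
        ... | inj₁ p≈a' = inj₁ (trans p≈a' (sym e))
        ... | inj₂ p≈b  = inj₂ p≈b

        respB : ∀ a {b b'} → b ≈ b' → Q a b' → Q a b
        respB a e h p≈ab with h (trans p≈ab (∨-cong refl e))
        ... | inj₁ p≈a = inj₁ p≈a
        ... | inj₂ p≈b' = inj₂ (trans p≈b' (sym e))

        least? : Dec (IsLeast p)
        least? = allDec (p ≤_) (λ x≈y p≤y → trans p≤y (∧-cong refl (sym x≈y))) (p ≤?_)

    J? : ∀ p → Dec (IsJoinIrreducible p)
    J? p = ¬? (least? p)
       ×-dec allDec (λ a → ∀ b → Q p a b) (respA p)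
               (λ a → allDec (Q p a) (respB p a) (Q? p a))

  ⊘ : ∀ {c' ℓ'} (L : DistributiveLattice c' ℓ') → IsFinite →
      DistributiveLattice.Carrier L → (Carrier → DistributiveLattice.Carrier L) →
      Carrier → Carrier → DistributiveLattice.Carrier L
  ⊘ L fin ⊥L e x y =
    foldr (λ p acc → if does (J? p ×-dec ((p ≤? x) ×-dec ¬? (p ≤? y)))
                     then e p ∨L acc else acc)
          ⊥L (IsFinite.enum fin)
    where
    open FiniteOps fin
    open DistributiveLattice L using () renaming (_∨_ to _∨L_)

IsConsonanceKernel : ∀ {c ℓ c' ℓ'} (D : DistributiveLattice c ℓ) (L : DistributiveLattice c' ℓ') →
  DistributiveLattice.Carrier L →
  (DistributiveLattice.Carrier D → DistributiveLattice.Carrier L) →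
  (DistributiveLattice.Carrier D → DistributiveLattice.Carrier L) → Set (c ⊔ ℓ ⊔ ℓ')
IsConsonanceKernel D L ⊥L f e =
  (∀ p → IsJoinIrreducible D p → ∀ q → IsLowerCover D q p → f p ≈L f q ∨L e p) ×
  (∀ p q → IsJoinIrreducible D p → IsJoinIrreducible D q →
     ¬ (_≤_ D p q) → ¬ (_≤_ D q p) → e p ∧L e q ≈L ⊥L)
  where
  open DistributiveLattice L using () renaming (_≈_ to _≈L_; _∨_ to _∨L_; _∧_ to _∧L_)

-- Every z ≤ x satisfies f z ≤ f (x ∧ y) ∨ (x ⊘ y), by well-founded induction on z: if z ≤ y
-- this is monotonicity; if z is a proper join a ∨ b it follows from the claim for a and b;
-- otherwise z is join-irreducible with lower cover z⁎, and f z = f z⁎ ∨ e_z, where e_z is a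
-- joinand of x ⊘ y. The reverse inequality holds because e_p ≤ f p. For meets, distributivity
-- gives f x ∧ f y = f (x ∧ y) ∨ ((x ⊘ y) ∧ (y ⊘ x)), and the second term is 0 because every
-- p ≤ x with p ≰ y is incomparable to every q ≤ y with q ≰ x.
module Submission where

open import Defs hiding (_≤_)
open import Level using (Level; _⊔_)
open import Algebra.Lattice.Bundles using (DistributiveLattice; Lattice)
open import Algebra.Lattice.Morphism.Structures using (module LatticeMorphisms)
open import Data.Bool using (if_then_else_)
open import Data.Empty using (⊥-elim)
open import Data.List using (List; []; _∷_; foldr; length; filter)
open import Data.List.Relation.Unary.Any as Any using (Any; here; there; any?; satisfied)
open import Data.Nat as ℕ using (ℕ; z≤n; s≤s)
import Data.Nat.Induction as ℕ
open import Data.Nat.Properties using (m≤n⇒m≤1+n)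
open import Data.Product using (_×_; _,_; ∃; ∃₂; proj₁; proj₂)
open import Data.Sum as Sum using (_⊎_; inj₁; inj₂)
open import Function using (id)
open import Induction.WellFounded using (WellFounded; module Subrelation; module All)
import Relation.Binary.Construct.On as On
import Relation.Binary.Lattice as Order
import Relation.Binary.Reasoning.PartialOrder as ≤-Reasoning
open import Relation.Nullary using (¬_; Dec; yes; no; does)
open import Relation.Nullary.Decidable using (¬?; _×-dec_; decidable-stable)
open import Relation.Unary using (Pred; Decidable)

module _ {a p q} {A : Set a} {P : Pred A p} {Q : Pred A q}
         (P? : Decidable P) (Q? : Decidable Q) (P⇒Q : ∀ {x} → P x → Q x) where

  length-filter-mono : ∀ xs → length (filter P? xs) ℕ.≤ length (filter Q? xs)
  length-filter-mono [] = z≤n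
  length-filter-mono (x ∷ xs) with P? x | Q? x
  ... | yes _  | yes _  = s≤s (length-filter-mono xs)
  ... | yes Px | no ¬Qx = ⊥-elim (¬Qx (P⇒Q Px))
  ... | no _   | yes _  = m≤n⇒m≤1+n (length-filter-mono xs)
  ... | no _   | no _   = length-filter-mono xs

  length-filter-strict : ∀ {xs} → Any (λ x → Q x × ¬ P x) xs →
                         length (filter P? xs) ℕ.< length (filter Q? xs)
  length-filter-strict {x ∷ xs} (here (Qx , ¬Px)) with P? x | Q? x
  ... | yes Px | _      = ⊥-elim (¬Px Px)
  ... | no _   | yes _  = s≤s (length-filter-mono xs)
  ... | no _   | no ¬Qx = ⊥-elim (¬Qx Qx)
  length-filter-strict {x ∷ xs} (there found) with P? x | Q? x
  ... | yes _  | yes _  = s≤s (length-filter-strict found)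
  ... | yes Px | no ¬Qx = ⊥-elim (¬Qx (P⇒Q Px))
  ... | no _   | yes _  = m≤n⇒m≤1+n (length-filter-strict found)
  ... | no _   | no _   = length-filter-strict found

-- The order x ≤ y is x ≈ x ∧ y, definitionally the order `_≤_` of Defs.
module LatticeOrder {c ℓ} (L : Lattice c ℓ) where
  open import Algebra.Lattice.Properties.Lattice L using (∨-∧-orderTheoreticLattice)
  open Order.Lattice ∨-∧-orderTheoreticLattice public
    using (_≤_; poset; x≤x∨y; y≤x∨y; ∨-least; x∧y≤x; x∧y≤y; ∧-greatest)
    renaming (refl to ≤-refl; reflexive to ≤-reflexive; trans to ≤-trans; antisym to ≤-antisym)
  open import Relation.Binary.Properties.Poset poset public using (_<_; <-respˡ-≈)

module _ {c₁ ℓ₁ c₂ ℓ₂} {L₁ : Lattice c₁ ℓ₁} {L₂ : Lattice c₂ ℓ₂}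
         {f : Lattice.Carrier L₁ → Lattice.Carrier L₂}
         (f-join : LatticeMorphisms.∨.IsMagmaHomomorphism
                     (Lattice.rawLattice L₁) (Lattice.rawLattice L₂) f) where
  private
    module L₁ = Lattice L₁
    module L₂ = Lattice L₂
    module ≤₁ = LatticeOrder L₁
    module ≤₂ = LatticeOrder L₂
  open LatticeMorphisms.∨.IsMagmaHomomorphism L₁.rawLattice L₂.rawLattice f-join

  ∨-homomorphism⇒monotone : ∀ {x y} → x ≤₁.≤ y → f x ≤₂.≤ f y
  ∨-homomorphism⇒monotone {x} {y} x≤y = begin
    f x           ≤⟨ ≤₂.x≤x∨y (f x) (f y) ⟩
    f x L₂.∨ f y  ≈⟨ L₂.sym (homo x y) ⟩
    f (x L₁.∨ y)  ≈⟨ ⟦⟧-cong (≤₁.≤-antisym (≤₁.∨-least x≤y ≤₁.≤-refl) (≤₁.y≤x∨y x y)) ⟩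
    f y           ∎
    where open ≤-Reasoning ≤₂.poset

-- `⊘` of Defs is definitionally an instance of ⋁.
module SelectedJoin {c ℓ} (L : Lattice c ℓ) (⊥ : Lattice.Carrier L)
                    {a} {A : Set a} (e : A → Lattice.Carrier L) where
  open Lattice L
  open LatticeOrder L

  ⋁ : ∀ {p} {P : Pred A p} → Decidable P → List A → Carrier
  ⋁ P? = foldr (λ x acc → if does (P? x) then e x ∨ acc else acc) ⊥

  module _ {p} {P : Pred A p} (P? : Decidable P) where

    ⋁-ind : ∀ {q} (Q : Pred Carrier q) → Q ⊥ → (∀ {x acc} → P x → Q acc → Q (e x ∨ acc)) →
            ∀ xs → Q (⋁ P? xs)
    ⋁-ind Q Q⊥ Q-step [] = Q⊥
    ⋁-ind Q Q⊥ Q-step (x ∷ xs) with P? x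
    ... | yes Px = Q-step Px (⋁-ind Q Q⊥ Q-step xs)
    ... | no _   = ⋁-ind Q Q⊥ Q-step xs

    ⋁-least : ∀ {u} → ⊥ ≤ u → (∀ {x} → P x → e x ≤ u) → ∀ xs → ⋁ P? xs ≤ u
    ⋁-least {u} ⊥≤u e≤u = ⋁-ind (_≤ u) ⊥≤u (λ Px acc≤u → ∨-least (e≤u Px) acc≤u)

    ⋁-upper : ∀ {u xs} → Any (λ x → P x × u ≤ e x) xs → u ≤ ⋁ P? xs
    ⋁-upper {xs = x ∷ xs} (here (Px , u≤ex)) with P? x
    ... | yes _  = ≤-trans u≤ex (x≤x∨y (e x) _)
    ... | no ¬Px = ⊥-elim (¬Px Px)
    ⋁-upper {xs = x ∷ xs} (there found) with P? x
    ... | yes _ = ≤-trans (⋁-upper found) (y≤x∨y (e x) _)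
    ... | no _  = ⋁-upper found

module _ {c ℓ} (L : DistributiveLattice c ℓ) (⊥ : DistributiveLattice.Carrier L)
         {a} {A : Set a} (e : A → DistributiveLattice.Carrier L) where
  open DistributiveLattice L
  open LatticeOrder lattice
  open SelectedJoin lattice ⊥ e

  ⋁-disjoint : ∀ {p q} {P : Pred A p} {Q : Pred A q} (P? : Decidable P) (Q? : Decidable Q) →
               (∀ {x y} → P x → Q y → e x ∧ e y ≤ ⊥) →
               ∀ xs ys → ⋁ P? xs ∧ ⋁ Q? ys ≤ ⊥
  ⋁-disjoint {P = P} P? Q? disjoint xs ys =
    ⋁-ind P? (λ t → t ∧ ⋁ Q? ys ≤ ⊥) (x∧y≤x ⊥ _)
      (λ Px acc≤⊥ → ≤-trans (≤-reflexive (∧-distribʳ-∨ _ _ _)) (∨-least (ex∧⋁Q≤⊥ Px) acc≤⊥)) xs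
    where
    ex∧⋁Q≤⊥ : ∀ {x} → P x → e x ∧ ⋁ Q? ys ≤ ⊥
    ex∧⋁Q≤⊥ {x} Px =
      ⋁-ind Q? (λ t → e x ∧ t ≤ ⊥) (x∧y≤y (e x) ⊥)
        (λ Qy acc≤⊥ → ≤-trans (≤-reflexive (∧-distribˡ-∨ _ _ _)) (∨-least (disjoint Px Qy) acc≤⊥)) ys

module JoinIrreducibility {c ℓ} (D : DistributiveLattice c ℓ) where
  open DistributiveLattice D
  open LatticeOrder lattice

  IsJoinIrreducible-resp : ∀ {p q} → p ≈ q → IsJoinIrreducible D p → IsJoinIrreducible D q
  IsJoinIrreducible-resp p≈q (¬least , irreducible) =
    (λ q-least → ¬least (λ r → ≤-trans (≤-reflexive p≈q) (q-least r))) ,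
    (λ a b q≈a∨b → Sum.map (trans (sym p≈q)) (trans (sym p≈q)) (irreducible a b (trans p≈q q≈a∨b)))

  IsProperJoin : Carrier → Carrier → Carrier → Set ℓ
  IsProperJoin z a b = z ≈ a ∨ b × ¬ z ≈ a × ¬ z ≈ b

  properJoin⇒<ˡ : ∀ {z a b} → IsProperJoin z a b → a < z
  properJoin⇒<ˡ {a = a} {b} (z≈a∨b , z≉a , _) =
    ≤-trans (x≤x∨y a b) (≤-reflexive (sym z≈a∨b)) , λ a≈z → z≉a (sym a≈z)

  properJoin⇒<ʳ : ∀ {z a b} → IsProperJoin z a b → b < z
  properJoin⇒<ʳ {a = a} {b} (z≈a∨b , _ , z≉b) =
    ≤-trans (y≤x∨y a b) (≤-reflexive (sym z≈a∨b)) , λ b≈z → z≉b (sym b≈z)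

module FiniteLattice {c ℓ} (D : DistributiveLattice c ℓ) (fin : IsFinite D) where
  open DistributiveLattice D
  open LatticeOrder lattice
  open JoinIrreducibility D
  open IsFinite fin
  open FiniteOps D fin public

  ∃? : ∀ {p} {P : Pred Carrier p} → (∀ {x y} → x ≈ y → P x → P y) → Decidable P → Dec (∃ P)
  ∃? P-resp P? with any? P? enum
  ... | yes found = yes (satisfied found)
  ... | no ¬found = no λ (x , Px) → ¬found (Any.map (λ x≈w → P-resp x≈w Px) (complete x))

  _<?_ : ∀ x y → Dec (x < y)
  x <? y = (x ≤? y) ×-dec ¬? (x ≟ y)

  rank : Carrier → ℕ
  rank x = length (filter (_≤? x) enum)

  rank-< : ∀ {x y} → x < y → rank x ℕ.< rank y
  rank-< {x} {y} (x≤y , x≉y) =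
    length-filter-strict (_≤? x) (_≤? y) (λ w≤x → ≤-trans w≤x x≤y) (Any.map y∉↓x (complete y))
    where
    y∉↓x : ∀ {w} → y ≈ w → w ≤ y × ¬ w ≤ x
    y∉↓x y≈w = ≤-reflexive (sym y≈w) , λ w≤x → x≉y (≤-antisym x≤y (≤-trans (≤-reflexive y≈w) w≤x))

  <-wellFounded : WellFounded _<_
  <-wellFounded = Subrelation.wellFounded rank-< (On.wellFounded rank ℕ.<-wellFounded)

  ¬least⇒∃≱ : ∀ {p} → ¬ IsLeast D p → ∃ λ w → ¬ p ≤ w
  ¬least⇒∃≱ {p} ¬least with ∃? (λ x≈y p≰x p≤y → p≰x (≤-trans p≤y (≤-reflexive (sym x≈y))))
                              (λ w → ¬? (p ≤? w))
  ... | yes found = found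
  ... | no none   = ⊥-elim (¬least λ w → decidable-stable (p ≤? w) (λ p≰w → none (w , p≰w)))

  properJoin? : ∀ z → Dec (∃₂ (IsProperJoin z))
  properJoin? z = ∃? (λ a≈a′ (b , split) → b , resp-left a≈a′ split)
                     (λ a → ∃? resp-right (λ b → (z ≟ (a ∨ b)) ×-dec ¬? (z ≟ a) ×-dec ¬? (z ≟ b)))
    where
    resp-left : ∀ {a a′ b} → a ≈ a′ → IsProperJoin z a b → IsProperJoin z a′ b
    resp-left a≈a′ (z≈a∨b , z≉a , z≉b) =
      trans z≈a∨b (∨-cong a≈a′ refl) , (λ z≈a′ → z≉a (trans z≈a′ (sym a≈a′))) , z≉b
    resp-right : ∀ {a b b′} → b ≈ b′ → IsProperJoin z a b → IsProperJoin z a b′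
    resp-right b≈b′ (z≈a∨b , z≉a , z≉b) =
      trans z≈a∨b (∨-cong refl b≈b′) , z≉a , λ z≈b′ → z≉b (trans z≈b′ (sym b≈b′))

  joinIrreducible⊎properJoin : ∀ z → ¬ IsLeast D z → IsJoinIrreducible D z ⊎ ∃₂ (IsProperJoin z)
  joinIrreducible⊎properJoin z ¬least with properJoin? z
  ... | yes split = inj₂ split
  ... | no ¬split = inj₁ (¬least , irreducible)
    where
    irreducible : ∀ a b → z ≈ a ∨ b → z ≈ a ⊎ z ≈ b
    irreducible a b z≈a∨b with z ≟ a | z ≟ b
    ... | yes z≈a | _       = inj₁ z≈a
    ... | no _    | yes z≈b = inj₂ z≈b
    ... | no z≉a  | no z≉b  = ⊥-elim (¬split (a , b , z≈a∨b , z≉a , z≉b))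

  -- The lower cover of p is the join of all r < p, seeded with some p ∧ w < p.
  lowerCover : ∀ {p} → IsJoinIrreducible D p → ∃ λ q → IsLowerCover D q p
  lowerCover {p} (¬least , irreducible) with ¬least⇒∃≱ ¬least
  ... | w , p≰w = q , q≤p , (λ q≈p → p≉q (sym q≈p)) , maximal
    where
    open SelectedJoin lattice (p ∧ w) id

    q : Carrier
    q = ⋁ (_<? p) enum

    q≤p : q ≤ p
    q≤p = ⋁-least (_<? p) (x∧y≤x p w) proj₁ enum

    p≉q : ¬ p ≈ q
    p≉q = ⋁-ind (_<? p) (λ t → ¬ p ≈ t) p≰w p≉r∨acc enum
      where
      p≉r∨acc : ∀ {r acc} → r < p → ¬ p ≈ acc → ¬ p ≈ r ∨ acc
      p≉r∨acc (_ , r≉p) p≉acc p≈r∨acc =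
        Sum.[ (λ p≈r → r≉p (sym p≈r)) , p≉acc ] (irreducible _ _ p≈r∨acc)

    maximal : ∀ r → q ≤ r → r ≤ p → r ≈ q ⊎ r ≈ p
    maximal r q≤r r≤p with r ≟ p
    ... | yes r≈p = inj₂ r≈p
    ... | no r≉p  = inj₁ (≤-antisym (⋁-upper (_<? p) (Any.map below (complete r))) q≤r)
      where
      below : ∀ {v} → r ≈ v → v < p × r ≤ v
      below r≈v = <-respˡ-≈ r≈v (r≤p , r≉p) , ≤-reflexive r≈v

module ConsonanceKernel {c ℓ c′ ℓ′ : Level}
    (D : DistributiveLattice c ℓ) (L : DistributiveLattice c′ ℓ′)
    (fin : IsFinite D)
    (⊥L : DistributiveLattice.Carrier L) (⊥L-least : IsLeast L ⊥L)
    (f : DistributiveLattice.Carrier D → DistributiveLattice.Carrier L)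
    (f-join : LatticeMorphisms.∨.IsMagmaHomomorphism
                (DistributiveLattice.rawLattice D) (DistributiveLattice.rawLattice L) f)
    (e : DistributiveLattice.Carrier D → DistributiveLattice.Carrier L)
    (e-cong : ∀ {p q} → DistributiveLattice._≈_ D p q →
                DistributiveLattice._≈_ L (e p) (e q))
    (kernel : IsConsonanceKernel D L ⊥L f e) where

  private
    module D = DistributiveLattice D
    module L = DistributiveLattice L
    module ≤D = LatticeOrder D.lattice
    module ≤L = LatticeOrder L.lattice
    open ≤L using (_≤_)
    open IsFinite fin using (enum; complete)
    open FiniteLattice D fin
    open JoinIrreducibility D
    open SelectedJoin L.lattice ⊥L e
    open LatticeMorphisms.∨.IsMagmaHomomorphism D.rawLattice L.rawLattice f-join
      using (⟦⟧-cong; homo)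

  f-mono : ∀ {x y} → x ≤D.≤ y → f x ≤ f y
  f-mono = ∨-homomorphism⇒monotone {L₁ = D.lattice} {L₂ = L.lattice} f-join

  _⊘ₑ_ : D.Carrier → D.Carrier → L.Carrier
  x ⊘ₑ y = ⊘ D L fin ⊥L e x y

  Separates : D.Carrier → D.Carrier → D.Carrier → Set (c ⊔ ℓ)
  Separates x y p = IsJoinIrreducible D p × p ≤D.≤ x × ¬ p ≤D.≤ y

  separates? : ∀ x y → Decidable (Separates x y)
  separates? x y p = J? p ×-dec ((p ≤? x) ×-dec ¬? (p ≤? y))

  e≤f : ∀ {p} → IsJoinIrreducible D p → e p ≤ f p
  e≤f {p} jp with lowerCover jp
  ... | q , q≺p =
    ≤L.≤-trans (≤L.y≤x∨y (f q) (e p)) (≤L.≤-reflexive (L.sym (proj₁ kernel p jp q q≺p)))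

  ⊘≤f : ∀ x y → x ⊘ₑ y ≤ f x
  ⊘≤f x y = ⋁-least (separates? x y) (⊥L-least (f x))
              (λ (jp , p≤x , _) → ≤L.≤-trans (e≤f jp) (f-mono p≤x)) enum

  e≤⊘ : ∀ {x y p} → Separates x y p → e p ≤ x ⊘ₑ y
  e≤⊘ {x} {y} {p} (jp , p≤x , p≰y) = ⋁-upper (separates? x y) (Any.map separated (complete p))
    where
    separated : ∀ {q} → p D.≈ q → Separates x y q × e p ≤ e q
    separated p≈q = (IsJoinIrreducible-resp p≈q jp ,
                     ≤D.≤-trans (≤D.≤-reflexive (D.sym p≈q)) p≤x ,
                     λ q≤y → p≰y (≤D.≤-trans (≤D.≤-reflexive p≈q) q≤y)) ,
                    ≤L.≤-reflexive (e-cong p≈q)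

  ⊘-disjoint : ∀ x y → (x ⊘ₑ y) L.∧ (y ⊘ₑ x) ≤ ⊥L
  ⊘-disjoint x y = ⋁-disjoint L ⊥L e (separates? x y) (separates? y x) incomparable enum enum
    where
    incomparable : ∀ {p q} → Separates x y p → Separates y x q → e p L.∧ e q ≤ ⊥L
    incomparable {p} {q} (jp , p≤x , p≰y) (jq , q≤y , q≰x) = ≤L.≤-reflexive
      (proj₂ kernel p q jp jq (λ p≤q → p≰y (≤D.≤-trans p≤q q≤y)) (λ q≤p → q≰x (≤D.≤-trans q≤p p≤x)))

  f≤f∧∨⊘ : ∀ x y → f x ≤ f (x D.∧ y) L.∨ (x ⊘ₑ y)
  f≤f∧∨⊘ x y = All.wfRec <-wellFounded _ (λ z → z ≤D.≤ x → f z ≤ bound) step x ≤D.≤-refl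
    where
    bound : L.Carrier
    bound = f (x D.∧ y) L.∨ (x ⊘ₑ y)

    open ≤-Reasoning ≤L.poset

    step : ∀ z → (∀ {r} → r ≤D.< z → r ≤D.≤ x → f r ≤ bound) → z ≤D.≤ x → f z ≤ bound
    step z ih z≤x with z ≤? y
    ... | yes z≤y = begin
      f z          ≤⟨ f-mono (≤D.∧-greatest z≤x z≤y) ⟩
      f (x D.∧ y)  ≤⟨ ≤L.x≤x∨y _ _ ⟩
      bound        ∎
    ... | no z≰y with joinIrreducible⊎properJoin z (λ z-least → z≰y (z-least y))
    ...   | inj₂ (a , b , split@(z≈a∨b , _)) = begin
      f z          ≈⟨ ⟦⟧-cong z≈a∨b ⟩
      f (a D.∨ b)  ≈⟨ homo a b ⟩
      f a L.∨ f b  ≤⟨ ≤L.∨-least (below (properJoin⇒<ˡ split)) (below (properJoin⇒<ʳ split)) ⟩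
      bound        ∎
      where
      below : ∀ {r} → r ≤D.< z → f r ≤ bound
      below r<z = ih r<z (≤D.≤-trans (proj₁ r<z) z≤x)
    ...   | inj₁ jz with lowerCover jz
    ...     | q , q≺z@(q≤z , q≉z , _) = begin
      f z          ≈⟨ proj₁ kernel z jz q q≺z ⟩
      f q L.∨ e z  ≤⟨ ≤L.∨-least (ih (q≤z , q≉z) (≤D.≤-trans q≤z z≤x))
                                 (≤L.≤-trans (e≤⊘ (jz , z≤x , z≰y)) (≤L.y≤x∨y _ _)) ⟩
      bound        ∎

  f≈f∧∨⊘ : ∀ x y → f x L.≈ f (x D.∧ y) L.∨ (x ⊘ₑ y)
  f≈f∧∨⊘ x y =
    ≤L.≤-antisym (f≤f∧∨⊘ x y) (≤L.∨-least (f-mono (≤D.x∧y≤x x y)) (⊘≤f x y))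

  ∧-homo : ∀ x y → f (x D.∧ y) L.≈ f x L.∧ f y
  ∧-homo x y = ≤L.≤-antisym
    (≤L.∧-greatest (f-mono (≤D.x∧y≤x x y)) (f-mono (≤D.x∧y≤y x y)))
    (begin
      f x L.∧ f y
        ≈⟨ L.∧-cong (f≈f∧∨⊘ x y) (L.trans (f≈f∧∨⊘ y x) (L.∨-cong (⟦⟧-cong (D.∧-comm y x)) L.refl)) ⟩
      (f∧ L.∨ (x ⊘ₑ y)) L.∧ (f∧ L.∨ (y ⊘ₑ x))
        ≈⟨ L.sym (L.∨-distribˡ-∧ f∧ _ _) ⟩
      f∧ L.∨ ((x ⊘ₑ y) L.∧ (y ⊘ₑ x))
        ≤⟨ ≤L.∨-least ≤L.≤-refl (≤L.≤-trans (⊘-disjoint x y) (⊥L-least f∧)) ⟩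
      f∧ ∎)
    where
    f∧ : L.Carrier
    f∧ = f (x D.∧ y)
    open ≤-Reasoning ≤L.poset

lemma3p2 : ∀ {c ℓ c′ ℓ′ : Level}
    (D : DistributiveLattice c ℓ) (L : DistributiveLattice c′ ℓ′)
    (fin : IsFinite D)
    (⊥L : DistributiveLattice.Carrier L) (⊥L-least : IsLeast L ⊥L)
    (f : DistributiveLattice.Carrier D → DistributiveLattice.Carrier L)
    (f-join : LatticeMorphisms.∨.IsMagmaHomomorphism
                (DistributiveLattice.rawLattice D) (DistributiveLattice.rawLattice L) f)
    (e : DistributiveLattice.Carrier D → DistributiveLattice.Carrier L)
    (e-cong : ∀ {p q} → DistributiveLattice._≈_ D p q →
                DistributiveLattice._≈_ L (e p) (e q))
    (kernel : IsConsonanceKernel D L ⊥L f e) →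
    (∀ x y → DistributiveLattice._≈_ L (f x)
               (DistributiveLattice._∨_ L (f (DistributiveLattice._∧_ D x y))
                                          (⊘ D L fin ⊥L e x y)))
    × LatticeMorphisms.IsLatticeHomomorphism
        (DistributiveLattice.rawLattice D) (DistributiveLattice.rawLattice L) f
lemma3p2 D L fin ⊥L ⊥L-least f f-join e e-cong kernel =
  f≈f∧∨⊘ , record
    { isRelHomomorphism = isRelHomomorphism
    ; ∧-homo            = ∧-homo
    ; ∨-homo            = homo
    }
  where
  open ConsonanceKernel D L fin ⊥L ⊥L-least f f-join e e-cong kernel
  open LatticeMorphisms.∨.IsMagmaHomomorphism
    (DistributiveLattice.rawLattice D) (DistributiveLattice.rawLattice L) f-join
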